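{- Let $V$ and $W$ be finite sets with $|V|=|W|$, let $\mathcal O_1\subseteq 2^V$ and $\mathcal O_2\subseteq 2^W$, and let $\eta:\mathcal O_1^\cap\to\mathcal O_2^\cap$ be a faithful correspondence between $\mathcal O_1$ and $\mathcal O_2$. Then there exists a bijection $\varphi:V\to W$ whose elementwise extension to subsets of $V$ (i.e. $X\mapsto\varphi(X)$) coincides with $\eta$ on $\mathcal O_1^\cap$. Moreover, this extension maps the companion sets of $\mathcal O_1$ bijectively onto the companion sets of $\mathcal O_2$, preserving their sizes.
   Context: For a finite set $V$ and a family $\mathcal O\subseteq 2^V$, the neighborhood of $x\in V$ is $\mathcal N_{\mathcal O}(x)=\{X\in\mathcal O\mid x\in X\}$. Two elements $x,y\in V$ are companions with respect to $\mathcal O$, written $x\sim_{\mathcal O}y$, if $\mathcal N_{\mathcal O}(x)=\mathcal N_{\mathcal O}(y)$; the equivalence classes of $\sim_{\mathcal O}$ on $V$ are called companion sets (these are the nonempty regions of the Venn diagram of $\mathcal O$ inside $V$, including the outer region $V\setminus\bigcup\mathcal O$ if nonempty). $\mathcal O^\cap$ denotes the smallest family of sets containing $\mathcal O$ and closed under intersection of two sets. A faithful correspondence between $\mathcal O_1\subseteq 2^V$ and $\mathcal O_2\subseteq 2^W$ is a bijection $\eta:\mathcal O_1^\cap\to\mathcal O_2^\cap$ such that (i) $|X|=|\eta(X)|$ for all $X\in\mathcal O_1^\cap$, and (ii) $\eta(X\cap Y)=\eta(X)\cap\eta(Y)$ for all $X,Y\in\mathcal O_1^\cap$. -}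

module Defs where

open import Data.Nat using (ℕ)
open import Data.Bool using (Bool)
import Data.Bool as B
open import Data.Fin using (Fin; _≟_)
open import Data.Fin.Subset using (Subset; _∈_; _∩_; ∣_∣)
open import Data.Fin.Subset.Properties using (_∈?_)
open import Data.Fin.Properties using (any?)
open import Data.List using (List; map)
open import Data.List.Properties using (≡-dec)
open import Data.List.Membership.Propositional renaming (_∈_ to _∈ₗ_)
open import Data.Vec using (tabulate; lookup)
open import Data.Product using (∃; _×_; _,_)
open import Relation.Nullary using (does)
open import Relation.Nullary.Decidable using (_×-dec_)
open import Relation.Binary.PropositionalEquality using (_≡_)

Family : ℕ → Set
Family n = List (Subset n)

data Cl {n : ℕ} (O : Family n) : Subset n → Set where
  base  : ∀ {X} → X ∈ₗ O → Cl O X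
  inter : ∀ {X Y} → Cl O X → Cl O Y → Cl O (X ∩ Y)

-- Neighbourhood N_O(x), recorded as the membership pattern of x in the
-- members of O (in list order).
nbhd : ∀ {n} → Family n → Fin n → List Bool
nbhd O x = map (λ X → lookup X x) O

Companion : ∀ {n} → Family n → Fin n → Fin n → Set
Companion O x y = nbhd O x ≡ nbhd O y

companionSetOf : ∀ {n} → Family n → Fin n → Subset n
companionSetOf O x = tabulate (λ y → does (≡-dec B._≟_ (nbhd O x) (nbhd O y)))

IsCompanionSet : ∀ {n} → Family n → Subset n → Set
IsCompanionSet O C = ∃ λ x → C ≡ companionSetOf O x

image : ∀ {n m} → (Fin n → Fin m) → Subset n → Subset m
image f X = tabulate (λ y → does (any? (λ x → (x ∈? X) ×-dec (f x ≟ y))))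

-- Faithful correspondence η : O₁^∩ → O₂^∩ (η given as a function on all
-- subsets; only its behaviour on O₁^∩ matters).
record FaithfulCorrespondence {n m : ℕ} (O₁ : Family n) (O₂ : Family m)
                              (η : Subset n → Subset m) : Set where
  field
    maps : ∀ {X} → Cl O₁ X → Cl O₂ (η X)
    inj  : ∀ {X Y} → Cl O₁ X → Cl O₁ Y → η X ≡ η Y → X ≡ Y
    surj : ∀ {Y} → Cl O₂ Y → ∃ λ X → Cl O₁ X × η X ≡ Y
    size : ∀ {X} → Cl O₁ X → ∣ X ∣ ≡ ∣ η X ∣
    hom  : ∀ {X Y} → Cl O₁ X → Cl O₁ Y → η (X ∩ Y) ≡ η X ∩ η Y

module Submission where

-- Every member of O₁^∩ has the same size as its η-image, and η respects
-- intersections, so by inclusion–exclusion each region of the Venn diagram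
-- of O₁ (points with a prescribed membership pattern in the members of O₁)
-- has the same size as the corresponding region of the diagram of η(O₁).
-- Matching equal-sized regions point by point gives a permutation φ that
-- carries membership in A ∈ O₁ to membership in η A; hence φ(X) = η X on
-- O₁^∩. Since η is onto O₂^∩, two points are separated by O₁ exactly when
-- their images are separated by O₂, so φ maps companion sets to companion sets.

open import Algebra.Bundles using (CommutativeMonoid)
import Algebra.Properties.CommutativeSemigroup as CommutativeSemigroupProperties
open import Data.Bool using (Bool; true; false; _∧_; not; T)
import Data.Bool as Bool
open import Data.Bool.Properties using (T-≡)
open import Data.Fin using (Fin; zero; suc; punchIn)
open import Data.Fin.Permutation as Perm using (Permutation; _⟨$⟩ʳ_; _⟨$⟩ˡ_; insert; insert-punchIn)
open import Data.Fin.Properties using (any?) renaming (_≟_ to _≟ᶠ_)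
open import Data.Fin.Subset using (Subset; ∣_∣; _∩_; ∁; ⊤; ⊥; _∈_)
open import Data.Fin.Subset.Properties
  using (_∈?_; ∩-commutativeMonoid; ∩-identityˡ; ∩-identityʳ; ∩-zeroʳ; ∩-assoc)
open import Data.List using (List; []; _∷_; map)
open import Data.List.Properties using (≡-dec; map-cong-local; map-∘; ∷-injective)
open import Data.List.Relation.Unary.All as All using (All; []; _∷_)
open import Data.Nat using (ℕ; zero; suc; _+_; _∸_)
open import Data.Nat.Properties using (+-0-commutativeMonoid; +-suc; +-cancelˡ-≡; m+n∸m≡n)
open import Algebra.Properties.CommutativeMonoid.Sum +-0-commutativeMonoid
  using (sum; sum-remove; sum-permute)
open import Data.Product using (∃; _,_; _×_; proj₁; proj₂)
open import Data.Vec using (Vec; tabulate; lookup)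
open import Data.Vec.Properties
  using (lookup∘tabulate; tabulate∘lookup; tabulate-cong; lookup-zipWith; lookup-replicate;
         lookup-map; []=⇒lookup; lookup⇒[]=)
open import Function using (_∘_)
open import Function.Bundles using (Equivalence; _⇔_; mk⇔; _⤖_; Bijection)
open import Function.Construct.Composition using (_⇔-∘_)
open import Function.Construct.Symmetry using (⇔-sym)
open import Function.Properties.Inverse using (↔⇒⤖)
open import Relation.Binary.Definitions using (DecidableEquality)
open import Relation.Binary.PropositionalEquality
open import Relation.Nullary using (does; yes; no)
open import Relation.Nullary.Decidable using (dec-true; does-⇔; T?; _×-dec_)

open import Defs

indicator : Bool → ℕ
indicator true  = 1
indicator false = 0

∣tabulate∣≡sum : ∀ {n} (p : Fin n → Bool) → ∣ tabulate p ∣ ≡ sum (indicator ∘ p)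
∣tabulate∣≡sum {zero}  p = refl
∣tabulate∣≡sum {suc n} p with p zero
... | true  = cong suc (∣tabulate∣≡sum (p ∘ suc))
... | false = ∣tabulate∣≡sum (p ∘ suc)

∣tabulate∣-punchIn : ∀ {n} (p : Fin (suc n) → Bool) i →
                     ∣ tabulate p ∣ ≡ indicator (p i) + ∣ tabulate (p ∘ punchIn i) ∣
∣tabulate∣-punchIn p i = begin
  ∣ tabulate p ∣                                 ≡⟨ ∣tabulate∣≡sum p ⟩
  sum (indicator ∘ p)                            ≡⟨ sum-remove (indicator ∘ p) ⟩
  indicator (p i) + sum (indicator ∘ p ∘ punchIn i)
    ≡⟨ cong (indicator (p i) +_) (∣tabulate∣≡sum (p ∘ punchIn i)) ⟨
  indicator (p i) + ∣ tabulate (p ∘ punchIn i) ∣ ∎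
  where open ≡-Reasoning

∣tabulate∣-permute : ∀ {n} (p : Fin n → Bool) (π : Permutation n n) →
                     ∣ tabulate (p ∘ (π ⟨$⟩ʳ_)) ∣ ≡ ∣ tabulate p ∣
∣tabulate∣-permute p π = begin
  ∣ tabulate (p ∘ (π ⟨$⟩ʳ_)) ∣ ≡⟨ ∣tabulate∣≡sum (p ∘ (π ⟨$⟩ʳ_)) ⟩
  sum (indicator ∘ p ∘ (π ⟨$⟩ʳ_)) ≡⟨ sum-permute (indicator ∘ p) π ⟨
  sum (indicator ∘ p)            ≡⟨ ∣tabulate∣≡sum p ⟨
  ∣ tabulate p ∣                 ∎
  where open ≡-Reasoning

∣p∣≡∣p∩q∣+∣p∩∁q∣ : ∀ {n} (p q : Subset n) → ∣ p ∣ ≡ ∣ p ∩ q ∣ + ∣ p ∩ ∁ q ∣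
∣p∣≡∣p∩q∣+∣p∩∁q∣ Vec.[]            Vec.[]            = refl
∣p∣≡∣p∩q∣+∣p∩∁q∣ (true  Vec.∷ p) (true  Vec.∷ q) = cong suc (∣p∣≡∣p∩q∣+∣p∩∁q∣ p q)
∣p∣≡∣p∩q∣+∣p∩∁q∣ (true  Vec.∷ p) (false Vec.∷ q) =
  trans (cong suc (∣p∣≡∣p∩q∣+∣p∩∁q∣ p q)) (sym (+-suc _ _))
∣p∣≡∣p∩q∣+∣p∩∁q∣ (false Vec.∷ p) (_     Vec.∷ q) = ∣p∣≡∣p∩q∣+∣p∩∁q∣ p q

∣p∩∁q∩r∣≡∣p∩r∣∸∣p∩q∩r∣ : ∀ {n} (p q r : Subset n) → ∣ p ∩ ∁ q ∩ r ∣ ≡ ∣ p ∩ r ∣ ∸ ∣ (p ∩ q) ∩ r ∣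
∣p∩∁q∩r∣≡∣p∩r∣∸∣p∩q∩r∣ {n} p q r = begin
  ∣ p ∩ ∁ q ∩ r ∣                               ≡⟨ m+n∸m≡n ∣ (p ∩ q) ∩ r ∣ ∣ p ∩ ∁ q ∩ r ∣ ⟨
  ∣ (p ∩ q) ∩ r ∣ + ∣ p ∩ ∁ q ∩ r ∣ ∸ ∣ (p ∩ q) ∩ r ∣ ≡⟨ cong (_∸ ∣ (p ∩ q) ∩ r ∣) split ⟨
  ∣ p ∩ r ∣ ∸ ∣ (p ∩ q) ∩ r ∣                   ∎
  where
  open ≡-Reasoning
  open CommutativeSemigroupProperties (CommutativeMonoid.commutativeSemigroup (∩-commutativeMonoid n))
  split : ∣ p ∩ r ∣ ≡ ∣ (p ∩ q) ∩ r ∣ + ∣ p ∩ ∁ q ∩ r ∣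
  split = trans (∣p∣≡∣p∩q∣+∣p∩∁q∣ (p ∩ r) q)
                (cong₂ (λ s t → ∣ s ∣ + ∣ t ∣) (xy∙z≈xz∙y p r q) (xy∙z≈x∙zy p r (∁ q)))

≗-lookup⇒≡ : ∀ {A : Set} {n} {xs ys : Vec A n} → (∀ i → lookup xs i ≡ lookup ys i) → xs ≡ ys
≗-lookup⇒≡ {xs = xs} {ys} eq = begin
  xs                   ≡⟨ tabulate∘lookup xs ⟨
  tabulate (lookup xs) ≡⟨ tabulate-cong eq ⟩
  tabulate (lookup ys) ≡⟨ tabulate∘lookup ys ⟩
  ys                   ∎
  where open ≡-Reasoning

module _ {n} (π : Permutation n n) where

  image-permutation : ∀ X → image (π ⟨$⟩ʳ_) X ≡ tabulate (lookup X ∘ (π ⟨$⟩ˡ_))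
  image-permutation X = tabulate-cong λ y → does-⇔ (mk⇔ (to y) (from y))
    (any? λ x → (x ∈? X) ×-dec (π ⟨$⟩ʳ x ≟ᶠ y)) (T? (lookup X (π ⟨$⟩ˡ y)))
    where
    to : ∀ y → (∃ λ x → x ∈ X × π ⟨$⟩ʳ x ≡ y) → T (lookup X (π ⟨$⟩ˡ y))
    to _ (x , x∈X , refl) =
      Equivalence.from T-≡ (trans (cong (lookup X) (Perm.inverseˡ π)) ([]=⇒lookup x∈X))
    from : ∀ y → T (lookup X (π ⟨$⟩ˡ y)) → ∃ λ x → x ∈ X × π ⟨$⟩ʳ x ≡ y
    from y t = π ⟨$⟩ˡ y , lookup⇒[]= _ X (Equivalence.to T-≡ t) , Perm.inverseʳ π

  lookup-image-permutation : ∀ X x → lookup (image (π ⟨$⟩ʳ_) X) (π ⟨$⟩ʳ x) ≡ lookup X x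
  lookup-image-permutation X x = begin
    lookup (image (π ⟨$⟩ʳ_) X) (π ⟨$⟩ʳ x)
      ≡⟨ cong (λ S → lookup S (π ⟨$⟩ʳ x)) (image-permutation X) ⟩
    lookup (tabulate (lookup X ∘ (π ⟨$⟩ˡ_))) (π ⟨$⟩ʳ x) ≡⟨ lookup∘tabulate _ (π ⟨$⟩ʳ x) ⟩
    lookup X (π ⟨$⟩ˡ (π ⟨$⟩ʳ x))                         ≡⟨ cong (lookup X) (Perm.inverseˡ π) ⟩
    lookup X x                                          ∎
    where open ≡-Reasoning

  image-permutation-injective : ∀ X Y → image (π ⟨$⟩ʳ_) X ≡ image (π ⟨$⟩ʳ_) Y → X ≡ Y
  image-permutation-injective X Y eq = ≗-lookup⇒≡ λ x →
    trans (sym (lookup-image-permutation X x))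
          (trans (cong (λ S → lookup S (π ⟨$⟩ʳ x)) eq) (lookup-image-permutation Y x))

  ∣image-permutation∣ : ∀ X → ∣ image (π ⟨$⟩ʳ_) X ∣ ≡ ∣ X ∣
  ∣image-permutation∣ X = begin
    ∣ image (π ⟨$⟩ʳ_) X ∣                 ≡⟨ cong ∣_∣ (image-permutation X) ⟩
    ∣ tabulate (lookup X ∘ (π ⟨$⟩ˡ_)) ∣ ≡⟨ ∣tabulate∣-permute (lookup X) (Perm.flip π) ⟩
    ∣ tabulate (lookup X) ∣             ≡⟨ cong ∣_∣ (tabulate∘lookup X) ⟩
    ∣ X ∣                               ∎
    where open ≡-Reasoning

module _ {C : Set} (_≟_ : DecidableEquality C) where

  fibre : ∀ {n} → (Fin n → C) → C → Subset n
  fibre f c = tabulate (λ x → does (f x ≟ c))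

  ∣fibre∣-punchIn : ∀ {n} (f : Fin (suc n) → C) i c →
                    ∣ fibre f c ∣ ≡ indicator (does (f i ≟ c)) + ∣ fibre (f ∘ punchIn i) c ∣
  ∣fibre∣-punchIn f i c = ∣tabulate∣-punchIn (λ x → does (f x ≟ c)) i

  ∣fibre∣≡suc⇒∃ : ∀ {n k} (f : Fin n → C) c → ∣ fibre f c ∣ ≡ suc k → ∃ λ x → f x ≡ c
  ∣fibre∣≡suc⇒∃ {zero}  f c ()
  ∣fibre∣≡suc⇒∃ {suc n} f c eq with f zero ≟ c
  ... | yes f0≡c = zero , f0≡c
  ... | no  _    = let x , fx≡c = ∣fibre∣≡suc⇒∃ (f ∘ suc) c eq in suc x , fx≡c

  equal-fibres⇒permutation : ∀ {n} (f g : Fin n → C) → (∀ c → ∣ fibre f c ∣ ≡ ∣ fibre g c ∣) →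
                             ∃ λ (π : Permutation n n) → ∀ x → g (π ⟨$⟩ʳ x) ≡ f x
  equal-fibres⇒permutation {zero}  f g _    = Perm.id , λ ()
  equal-fibres⇒permutation {suc n} f g same = insert zero y (proj₁ rest) , matches
    where
    ∣fibre-f0∣ : ∣ fibre f (f zero) ∣ ≡ suc ∣ fibre (f ∘ suc) (f zero) ∣
    ∣fibre-f0∣ = trans (∣fibre∣-punchIn f zero (f zero))
                       (cong (λ b → indicator b + ∣ fibre (f ∘ suc) (f zero) ∣) (dec-true (f zero ≟ f zero) refl))
    y∈fibre : ∃ λ y → g y ≡ f zero
    y∈fibre = ∣fibre∣≡suc⇒∃ g (f zero) (trans (sym (same (f zero))) ∣fibre-f0∣)
    y = proj₁ y∈fibre
    gy≡f0 : g y ≡ f zero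
    gy≡f0 = proj₂ y∈fibre
    same′ : ∀ c → ∣ fibre (f ∘ suc) c ∣ ≡ ∣ fibre (g ∘ punchIn y) c ∣
    same′ c = +-cancelˡ-≡ (indicator (does (f zero ≟ c))) _ _ (begin
      indicator (does (f zero ≟ c)) + ∣ fibre (f ∘ suc) c ∣ ≡⟨ ∣fibre∣-punchIn f zero c ⟨
      ∣ fibre f c ∣                                        ≡⟨ same c ⟩
      ∣ fibre g c ∣                                        ≡⟨ ∣fibre∣-punchIn g y c ⟩
      indicator (does (g y ≟ c)) + ∣ fibre (g ∘ punchIn y) c ∣
        ≡⟨ cong (λ z → indicator (does (z ≟ c)) + ∣ fibre (g ∘ punchIn y) c ∣) gy≡f0 ⟩
      indicator (does (f zero ≟ c)) + ∣ fibre (g ∘ punchIn y) c ∣ ∎)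
      where open ≡-Reasoning
    rest = equal-fibres⇒permutation (f ∘ suc) (g ∘ punchIn y) same′
    matches : ∀ x → g (insert zero y (proj₁ rest) ⟨$⟩ʳ x) ≡ f x
    matches zero    = gy≡f0
    matches (suc x) = trans (cong g (insert-punchIn zero y (proj₁ rest) x)) (proj₂ rest x)

lookup-∩ : ∀ {n} (X Y : Subset n) x → lookup (X ∩ Y) x ≡ lookup X x ∧ lookup Y x
lookup-∩ X Y x = lookup-zipWith _∧_ x X Y

venn : ∀ {n} → Family n → List Bool → Subset n
venn []      []          = ⊤
venn (A ∷ L) (true  ∷ b) = A ∩ venn L b
venn (A ∷ L) (false ∷ b) = ∁ A ∩ venn L b
venn _       _           = ⊥

_≟ᴸ_ : DecidableEquality (List Bool)
_≟ᴸ_ = ≡-dec Bool._≟_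

lookup-venn : ∀ {n} (L : Family n) b x → lookup (venn L b) x ≡ does (nbhd L x ≟ᴸ b)
lookup-venn []      []          x = lookup-replicate x true
lookup-venn []      (_ ∷ _)     x = lookup-replicate x false
lookup-venn (_ ∷ _) []          x = lookup-replicate x false
lookup-venn (A ∷ L) (true  ∷ b) x =
  trans (lookup-∩ A (venn L b) x) (cong₂ _∧_ (does-≟true (lookup A x)) (lookup-venn L b x))
  where
  does-≟true : ∀ a → a ≡ does (a Bool.≟ true)
  does-≟true true  = refl
  does-≟true false = refl
lookup-venn (A ∷ L) (false ∷ b) x =
  trans (lookup-∩ (∁ A) (venn L b) x)
        (cong₂ _∧_ (trans (lookup-map x not A) (does-≟false (lookup A x))) (lookup-venn L b x))
  where
  does-≟false : ∀ a → not a ≡ does (a Bool.≟ false)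
  does-≟false true  = refl
  does-≟false false = refl

fibre-nbhd≡venn : ∀ {n} (L : Family n) b → fibre _≟ᴸ_ (nbhd L) b ≡ venn L b
fibre-nbhd≡venn L b = ≗-lookup⇒≡ λ x → trans (lookup∘tabulate _ x) (sym (lookup-venn L b x))

map-cong-local⁻ : ∀ {A B : Set} {f g : A → B} xs → map f xs ≡ map g xs → All (λ x → f x ≡ g x) xs
map-cong-local⁻ []       _  = []
map-cong-local⁻ (x ∷ xs) eq = let fx≡gx , rest = ∷-injective eq in fx≡gx ∷ map-cong-local⁻ xs rest

Indistinguishable : ∀ {n} → Family n → Fin n → Fin n → Set
Indistinguishable O a b = ∀ X → Cl O X → lookup X a ≡ lookup X b

companion⇔indistinguishable : ∀ {n} (O : Family n) a b → Companion O a b ⇔ Indistinguishable O a b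
companion⇔indistinguishable O a b = mk⇔ (λ eq → closure (map-cong-local⁻ O eq)) members
  where
  members : Indistinguishable O a b → Companion O a b
  members h = map-cong-local (All.tabulate λ X∈O → h _ (base X∈O))

  closure : All (λ X → lookup X a ≡ lookup X b) O → Indistinguishable O a b
  closure agree _ (base X∈O)          = All.lookup agree X∈O
  closure agree _ (inter {X} {Y} x y) = begin
    lookup (X ∩ Y) a          ≡⟨ lookup-∩ X Y a ⟩
    lookup X a ∧ lookup Y a   ≡⟨ cong₂ _∧_ (closure agree X x) (closure agree Y y) ⟩
    lookup X b ∧ lookup Y b   ≡⟨ lookup-∩ X Y b ⟨
    lookup (X ∩ Y) b          ∎
    where open ≡-Reasoning

module Correspondence {n} {O₁ O₂ : Family n} {η : Subset n → Subset n}
                      (fc : FaithfulCorrespondence O₁ O₂ η) where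
  open FaithfulCorrespondence fc

  -- ⊤ ↦ ⊤ is added because V itself need not belong to O₁^∩.
  data Corresponding : Subset n → Subset n → Set where
    ⊤↦⊤  : Corresponding ⊤ ⊤
    cl↦η : ∀ {Z} → Cl O₁ Z → Corresponding Z (η Z)

  ∣Corresponding∣ : ∀ {Z Z′} → Corresponding Z Z′ → ∣ Z ∣ ≡ ∣ Z′ ∣
  ∣Corresponding∣ ⊤↦⊤     = refl
  ∣Corresponding∣ (cl↦η z) = size z

  Corresponding-∩ : ∀ {Z Z′ A} → Corresponding Z Z′ → Cl O₁ A → Corresponding (Z ∩ A) (Z′ ∩ η A)
  Corresponding-∩ {A = A} ⊤↦⊤ a =
    subst₂ Corresponding (sym (∩-identityˡ A)) (sym (∩-identityˡ (η A))) (cl↦η a)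
  Corresponding-∩ {Z} {A = A} (cl↦η z) a = subst (Corresponding (Z ∩ A)) (hom z a) (cl↦η (inter z a))

  ∣∩venn∣-preserved : ∀ {L} → All (Cl O₁) L → ∀ b {Z Z′} → Corresponding Z Z′ →
                      ∣ Z ∩ venn L b ∣ ≡ ∣ Z′ ∩ venn (map η L) b ∣
  ∣∩venn∣-preserved []       []      {Z} {Z′} z =
    trans (cong ∣_∣ (∩-identityʳ Z)) (trans (∣Corresponding∣ z) (cong ∣_∣ (sym (∩-identityʳ Z′))))
  ∣∩venn∣-preserved []       (_ ∷ _) {Z} {Z′} z =
    trans (cong ∣_∣ (∩-zeroʳ Z)) (cong ∣_∣ (sym (∩-zeroʳ Z′)))
  ∣∩venn∣-preserved (_ ∷ _)  []      {Z} {Z′} z =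
    trans (cong ∣_∣ (∩-zeroʳ Z)) (cong ∣_∣ (sym (∩-zeroʳ Z′)))
  ∣∩venn∣-preserved {A ∷ L} (a ∷ as) (true ∷ b) {Z} {Z′} z = begin
    ∣ Z ∩ A ∩ venn L b ∣                   ≡⟨ cong ∣_∣ (∩-assoc Z A (venn L b)) ⟨
    ∣ (Z ∩ A) ∩ venn L b ∣                 ≡⟨ ∣∩venn∣-preserved as b (Corresponding-∩ z a) ⟩
    ∣ (Z′ ∩ η A) ∩ venn (map η L) b ∣      ≡⟨ cong ∣_∣ (∩-assoc Z′ (η A) (venn (map η L) b)) ⟩
    ∣ Z′ ∩ η A ∩ venn (map η L) b ∣        ∎
    where open ≡-Reasoning
  ∣∩venn∣-preserved {A ∷ L} (a ∷ as) (false ∷ b) {Z} {Z′} z = begin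
    ∣ Z ∩ ∁ A ∩ venn L b ∣                                   ≡⟨ ∣p∩∁q∩r∣≡∣p∩r∣∸∣p∩q∩r∣ Z A (venn L b) ⟩
    ∣ Z ∩ venn L b ∣ ∸ ∣ (Z ∩ A) ∩ venn L b ∣                 ≡⟨ cong₂ _∸_ (∣∩venn∣-preserved as b z)
                                                                   (∣∩venn∣-preserved as b (Corresponding-∩ z a)) ⟩
    ∣ Z′ ∩ venn (map η L) b ∣ ∸ ∣ (Z′ ∩ η A) ∩ venn (map η L) b ∣
      ≡⟨ ∣p∩∁q∩r∣≡∣p∩r∣∸∣p∩q∩r∣ Z′ (η A) (venn (map η L) b) ⟨
    ∣ Z′ ∩ ∁ (η A) ∩ venn (map η L) b ∣                      ∎
    where open ≡-Reasoning

  ∣venn∣-preserved : ∀ b → ∣ venn O₁ b ∣ ≡ ∣ venn (map η O₁) b ∣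
  ∣venn∣-preserved b = begin
    ∣ venn O₁ b ∣                 ≡⟨ cong ∣_∣ (∩-identityˡ (venn O₁ b)) ⟨
    ∣ ⊤ ∩ venn O₁ b ∣             ≡⟨ ∣∩venn∣-preserved (All.tabulate base) b ⊤↦⊤ ⟩
    ∣ ⊤ ∩ venn (map η O₁) b ∣     ≡⟨ cong ∣_∣ (∩-identityˡ (venn (map η O₁) b)) ⟩
    ∣ venn (map η O₁) b ∣         ∎
    where open ≡-Reasoning

  neighbourhood-matching : ∃ λ (π : Permutation n n) → ∀ x → nbhd (map η O₁) (π ⟨$⟩ʳ x) ≡ nbhd O₁ x
  neighbourhood-matching = equal-fibres⇒permutation _≟ᴸ_ (nbhd O₁) (nbhd (map η O₁)) λ b →
    trans (cong ∣_∣ (fibre-nbhd≡venn O₁ b))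
          (trans (∣venn∣-preserved b) (cong ∣_∣ (sym (fibre-nbhd≡venn (map η O₁) b))))

  module Matching (π : Permutation n n)
                  (matches : ∀ x → nbhd (map η O₁) (π ⟨$⟩ʳ x) ≡ nbhd O₁ x) where

    lookup-η : ∀ {X} → Cl O₁ X → ∀ x → lookup (η X) (π ⟨$⟩ʳ x) ≡ lookup X x
    lookup-η (base X∈O₁) x =
      All.lookup (map-cong-local⁻ O₁ (trans (map-∘ O₁) (matches x))) X∈O₁
    lookup-η (inter {X} {Y} cx cy) x = begin
      lookup (η (X ∩ Y)) (π ⟨$⟩ʳ x)                ≡⟨ cong (λ S → lookup S (π ⟨$⟩ʳ x)) (hom cx cy) ⟩
      lookup (η X ∩ η Y) (π ⟨$⟩ʳ x)                ≡⟨ lookup-∩ (η X) (η Y) (π ⟨$⟩ʳ x) ⟩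
      lookup (η X) (π ⟨$⟩ʳ x) ∧ lookup (η Y) (π ⟨$⟩ʳ x) ≡⟨ cong₂ _∧_ (lookup-η cx x) (lookup-η cy x) ⟩
      lookup X x ∧ lookup Y x                      ≡⟨ lookup-∩ X Y x ⟨
      lookup (X ∩ Y) x                             ∎
      where open ≡-Reasoning

    image≡η : ∀ X → Cl O₁ X → image (π ⟨$⟩ʳ_) X ≡ η X
    image≡η X cx = begin
      image (π ⟨$⟩ʳ_) X                  ≡⟨ image-permutation π X ⟩
      tabulate (lookup X ∘ (π ⟨$⟩ˡ_))    ≡⟨ tabulate-cong (λ y → sym (lookup-η′ y)) ⟩
      tabulate (lookup (η X))            ≡⟨ tabulate∘lookup (η X) ⟩
      η X                                ∎
      where
      open ≡-Reasoning
      lookup-η′ : ∀ y → lookup (η X) y ≡ lookup X (π ⟨$⟩ˡ y)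
      lookup-η′ y = trans (cong (lookup (η X)) (sym (Perm.inverseʳ π))) (lookup-η cx (π ⟨$⟩ˡ y))

    indistinguishable-transfer : ∀ a b →
      Indistinguishable O₁ a b ⇔ Indistinguishable O₂ (π ⟨$⟩ʳ a) (π ⟨$⟩ʳ b)
    indistinguishable-transfer a b = mk⇔ to from
      where
      to : Indistinguishable O₁ a b → Indistinguishable O₂ (π ⟨$⟩ʳ a) (π ⟨$⟩ʳ b)
      to h Y cy with surj cy
      ... | X , cx , refl = trans (lookup-η cx a) (trans (h X cx) (sym (lookup-η cx b)))
      from : Indistinguishable O₂ (π ⟨$⟩ʳ a) (π ⟨$⟩ʳ b) → Indistinguishable O₁ a b
      from h X cx = trans (sym (lookup-η cx a)) (trans (h (η X) (maps cx)) (lookup-η cx b))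

    companion-transfer : ∀ a b → Companion O₁ a b ⇔ Companion O₂ (π ⟨$⟩ʳ a) (π ⟨$⟩ʳ b)
    companion-transfer a b = ⇔-sym (companion⇔indistinguishable O₂ _ _)
                        ⇔-∘ (indistinguishable-transfer a b ⇔-∘ companion⇔indistinguishable O₁ a b)

    image-companionSetOf : ∀ x → image (π ⟨$⟩ʳ_) (companionSetOf O₁ x) ≡ companionSetOf O₂ (π ⟨$⟩ʳ x)
    image-companionSetOf x = begin
      image (π ⟨$⟩ʳ_) (companionSetOf O₁ x)               ≡⟨ image-permutation π (companionSetOf O₁ x) ⟩
      tabulate (lookup (companionSetOf O₁ x) ∘ (π ⟨$⟩ˡ_)) ≡⟨ tabulate-cong lookup-companionSetOf ⟩
      companionSetOf O₂ (π ⟨$⟩ʳ x)                        ∎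
      where
      open ≡-Reasoning
      lookup-companionSetOf : ∀ y → lookup (companionSetOf O₁ x) (π ⟨$⟩ˡ y) ≡ does (nbhd O₂ (π ⟨$⟩ʳ x) ≟ᴸ nbhd O₂ y)
      lookup-companionSetOf y = begin
        lookup (companionSetOf O₁ x) (π ⟨$⟩ˡ y)
          ≡⟨ lookup∘tabulate _ (π ⟨$⟩ˡ y) ⟩
        does (nbhd O₁ x ≟ᴸ nbhd O₁ (π ⟨$⟩ˡ y))
          ≡⟨ does-⇔ (companion-transfer x (π ⟨$⟩ˡ y)) (nbhd O₁ x ≟ᴸ nbhd O₁ (π ⟨$⟩ˡ y))
                    (nbhd O₂ (π ⟨$⟩ʳ x) ≟ᴸ nbhd O₂ (π ⟨$⟩ʳ (π ⟨$⟩ˡ y))) ⟩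
        does (nbhd O₂ (π ⟨$⟩ʳ x) ≟ᴸ nbhd O₂ (π ⟨$⟩ʳ (π ⟨$⟩ˡ y)))
          ≡⟨ cong (λ z → does (nbhd O₂ (π ⟨$⟩ʳ x) ≟ᴸ nbhd O₂ z)) (Perm.inverseʳ π) ⟩
        does (nbhd O₂ (π ⟨$⟩ʳ x) ≟ᴸ nbhd O₂ y)
          ∎

lemma2p4 : (n : ℕ) (O₁ O₂ : Family n) (η : Subset n → Subset n)
    → FaithfulCorrespondence O₁ O₂ η
    → ∃ λ (φ : Fin n ⤖ Fin n) →
        (∀ X → Cl O₁ X → image (Bijection.to φ) X ≡ η X)
        × (∀ C → IsCompanionSet O₁ C → IsCompanionSet O₂ (image (Bijection.to φ) C))
        × (∀ C C′ → IsCompanionSet O₁ C → IsCompanionSet O₁ C′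
             → image (Bijection.to φ) C ≡ image (Bijection.to φ) C′ → C ≡ C′)
        × (∀ D → IsCompanionSet O₂ D
             → ∃ λ C → IsCompanionSet O₁ C × image (Bijection.to φ) C ≡ D)
        × (∀ C → IsCompanionSet O₁ C → ∣ image (Bijection.to φ) C ∣ ≡ ∣ C ∣)
lemma2p4 n O₁ O₂ η fc =
    ↔⇒⤖ π
  , image≡η
  , (λ { _ (x , refl) → π ⟨$⟩ʳ x , image-companionSetOf x })
  , (λ C C′ _ _ → image-permutation-injective π C C′)
  , (λ { _ (y , refl) → companionSetOf O₁ (π ⟨$⟩ˡ y) , (π ⟨$⟩ˡ y , refl)
                      , trans (image-companionSetOf (π ⟨$⟩ˡ y)) (cong (companionSetOf O₂) (Perm.inverseʳ π)) })
  , (λ C _ → ∣image-permutation∣ π C)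
  where
  open Correspondence fc
  π = proj₁ neighbourhood-matching
  open Matching π (proj₂ neighbourhood-matching)
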